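{- Let $\mathbb{H}$ be a cyclic interval hypergraph on $[n]$, let $A,B$ be two distinct acyclic orientations of $\mathbb{H}$ with pseudo-join $X=X^{AB}$, and let $H\in\mathbb{H}_{\mathrm{cyc}}$. Let $\ell\in H$ with $X(H)=X(H,\ell)$, and let $\ell'\in H$ with $H_{AB}\le\ell'<X(H)$ and $X(H,\ell')>X(H)$. Let $(\tilde H_i,\tilde h_i)_{i=1}^r$ be an $(H,\ell')$-sequence realizing $X(H,\ell')$, i.e. with $\tilde h_r=X(H,\ell')$. Let $L\in\mathbb{H}$ be such that $\ell\in L$ and $L_{AB}>\ell$. If $X(H,\ell')\in H^+$, then $L_{AB}\notin\tilde H_i$ for every $i\in[2,r]$ such that $X(H)<\tilde h_i$.
   Context: $[x,y]=\{x,\dots,y\}$, $[n]=[1,n]$. A cyclic interval hypergraph $\mathbb{H}$ on $[n]$ is a set of nonempty subsets of $[n]$ containing all singletons, whose non-singleton members are regular, $[i,j]$ with $1\le i<j\le n$, $[i,j]\ne[n]$, or cyclic, $H=[j,n]\cup[1,i]$ with $1\le i<j\le n$ (these form $\mathbb{H}_{\mathrm{cyc}}$); for such cyclic $H$, $H^-=[1,i]$ and $H^+=[j,n]$, except that for $H=[n]$, $H^-=[1,n-1]$ and $H^+=\{n\}$. An orientation $A$ assigns to each $H\in\mathbb{H}$ a source $A(H)\in H$; a cycle is a sequence $(H_1,\dots,H_k)$, $k\ge2$, with $A(H_{i+1})\in H_i\setminus\{A(H_i)\}$ for $i\in[k-1]$ and $A(H_1)\in H_k\setminus\{A(H_k)\}$;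 $A$ is acyclic if it has no cycle. Pseudo-join: for distinct acyclic $A,B$ and $K\in\mathbb{H}$ let $K_{AB}=\max\{A(K),B(K)\}$. For $H\in\mathbb{H}$ and $\ell\in H$, an $(H,\ell)$-sequence is a sequence $(H_i,h_i)_{i=1}^k$ with $H_i\in\mathbb{H}$, $h_i\in H_i$, $H_1=H$, $h_1=\ell$, $h_i=(H_i)_{AB}$ for $i\ge2$, $h_i\in H_{i+1}$ and $h_i<h_{i+1}$ for $i\in[k-1]$, and $h_k\in H$. $X^{AB}(H,\ell)$ is the maximum of $h_k$ over all $(H,\ell)$-sequences, and $X^{AB}(H)=\min\{X^{AB}(H,\ell)\mid\ell\in H,\ \ell\ge H_{AB}\}$. -}

module Defs where

open import Data.Nat using (ℕ; zero; suc; _+_; _≤_; _<_; _⊔_)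
open import Data.Product using (Σ; _×_; ∃)
open import Data.Sum using (_⊎_)
open import Data.Empty using (⊥)
open import Relation.Binary.PropositionalEquality using (_≡_; _≢_)
open import Relation.Nullary using (¬_)

-- Descriptors of candidate hyperedges on [n] = {1,…,n}.
--   reg i j  denotes the regular interval [i,j]  (singletons are reg i i)
--   cyc i j  denotes the cyclic set [j,n] ∪ [1,i]  (1 ≤ i < j ≤ n)
data Interval : Set where
  reg : ℕ → ℕ → Interval
  cyc : ℕ → ℕ → Interval

Mem : ℕ → ℕ → Interval → Set
Mem n x (reg i j) = i ≤ x × x ≤ j
Mem n x (cyc i j) = (j ≤ x × x ≤ n) ⊎ (1 ≤ x × x ≤ i)

-- A regular interval is either a singleton,
-- or a non-singleton [i,j] different from [n].  A cyclic set [j,n] ∪ [1,i]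
-- (i < j) is either different from [n] (i.e. i + 1 < j), or is [n] itself,
-- which is canonically represented by i = n - 1, j = n (so that
-- H⁻ = [1,n-1], H⁺ = {n} as in the paper).
Valid : ℕ → Interval → Set
Valid n (reg i j) = 1 ≤ i × i ≤ j × j ≤ n × (i ≡ j ⊎ 1 < i ⊎ j < n)
Valid n (cyc i j) = 1 ≤ i × i < j × j ≤ n × (suc i < j ⊎ (suc i ≡ n × j ≡ n))

MemPlus : ℕ → ℕ → Interval → Set
MemPlus n x (reg i j) = ⊥
MemPlus n x (cyc i j) = j ≤ x × x ≤ n

record CIH (n : ℕ) : Set₁ where
  field
    E          : Interval → Set
    valid      : ∀ H → E H → Valid n H
    singletons : ∀ x → 1 ≤ x → x ≤ n → E (reg x x)
open CIH public

IsOrientation : ∀ {n} → CIH n → (Interval → ℕ) → Set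
IsOrientation {n} G A = ∀ H → E G H → Mem n (A H) H

CycStep : ℕ → (Interval → ℕ) → Interval → Interval → Set
CycStep n A H H' = Mem n (A H') H × A H' ≢ A H

record Cycle {n} (G : CIH n) (A : Interval → ℕ) : Set where
  field
    k     : ℕ
    2≤k   : 2 ≤ k
    Hs    : ℕ → Interval
    edges : ∀ i → 1 ≤ i → i ≤ k → E G (Hs i)
    steps : ∀ i → 1 ≤ i → i < k → CycStep n A (Hs i) (Hs (suc i))
    wrap  : CycStep n A (Hs k) (Hs 1)

Acyclic : ∀ {n} → CIH n → (Interval → ℕ) → Set
Acyclic G A = ¬ Cycle G A

Distinct : ∀ {n} → CIH n → (Interval → ℕ) → (Interval → ℕ) → Set
Distinct G A B = Σ Interval λ H → E G H × A H ≢ B H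

_AB : (Interval → ℕ) → (Interval → ℕ) → Interval → ℕ
(A AB) B K = A K ⊔ B K

record Seq {n} (G : CIH n) (A B : Interval → ℕ) (H : Interval) (ℓ : ℕ) : Set where
  field
    k      : ℕ
    1≤k    : 1 ≤ k
    Hs     : ℕ → Interval
    hs     : ℕ → ℕ
    edges  : ∀ i → 1 ≤ i → i ≤ k → E G (Hs i)
    mems   : ∀ i → 1 ≤ i → i ≤ k → Mem n (hs i) (Hs i)
    first  : Hs 1 ≡ H
    firstℓ : hs 1 ≡ ℓ
    isAB   : ∀ i → 2 ≤ i → i ≤ k → hs i ≡ (A AB) B (Hs i)
    link   : ∀ i → 1 ≤ i → i < k → Mem n (hs i) (Hs (suc i))
    incr   : ∀ i → 1 ≤ i → i < k → hs i < hs (suc i)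
    back   : Mem n (hs k) H
open Seq public

lastH : ∀ {n} {G : CIH n} {A B H ℓ} → Seq G A B H ℓ → ℕ
lastH S = hs S (k S)

IsXℓ : ∀ {n} → CIH n → (A B : Interval → ℕ) → Interval → ℕ → ℕ → Set
IsXℓ G A B H ℓ x =
  Σ (Seq G A B H ℓ) (λ S → lastH S ≡ x) × (∀ (S : Seq G A B H ℓ) → lastH S ≤ x)

IsX : ∀ {n} → CIH n → (A B : Interval → ℕ) → Interval → ℕ → Set
IsX {n} G A B H x =
  Σ ℕ (λ ℓ → Mem n ℓ H × (A AB) B H ≤ ℓ × IsXℓ G A B H ℓ x)
  × (∀ ℓ y → Mem n ℓ H → (A AB) B H ≤ ℓ → IsXℓ G A B H ℓ y → x ≤ y)

{-# OPTIONS --safe #-}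
-- Write a = L_AB. Since X(H) = X(H,ℓ), no (H,ℓ)-sequence ends above X(H). If X(H,ℓ') ≤ a, then
-- a ∈ H⁺ ⊆ H and (H,ℓ),(L,a) is such a sequence. Otherwise, a prefix of an (H,ℓ)-sequence ending
-- at some u ∈ H̃_q with u < h̃_q (q ≥ 2) continues along (H̃_q,h̃_q),…,(H̃_r,h̃_r) to end at
-- X(H,ℓ') > X(H). If a ∈ H̃_m with X(H) < h̃_m, walking up from m produces such a q either for the
-- prefix (H,ℓ),(L,a) or for the sequence realising X(H,ℓ): an interval containing two values
-- either contains everything between them or wraps around and contains [1, the smaller one].
module Submission where

open import Defs
open import Data.Nat
  using (ℕ; suc; _≤_; _<_; z≤n; s≤s; _≤?_; _<?_; _≤‴_; ≤‴-reflexive; ≤‴-step; ≤‴-refl)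
open import Data.Nat.Properties
open import Data.Empty using (⊥)
open import Data.Product using (Σ-syntax; _×_; _,_)
open import Data.Sum using (_⊎_; inj₁; inj₂; map₁)
open import Function using (_∘_)
open import Relation.Binary.PropositionalEquality using (_≡_; refl; sym; trans; subst)
open import Relation.Nullary using (¬_; Dec; yes; no; contradiction)

Mem⇒1≤ : ∀ {n x} K → Valid n K → Mem n x K → 1 ≤ x
Mem⇒1≤ (reg i j) (1≤i , _) (i≤x , _) = ≤-trans 1≤i i≤x
Mem⇒1≤ (cyc i j) (1≤i , i<j , _) (inj₁ (j≤x , _)) = ≤-trans 1≤i (≤-trans (<⇒≤ i<j) j≤x)
Mem⇒1≤ (cyc i j) _ (inj₂ (1≤x , _)) = 1≤x

Mem⇒≤n : ∀ {n x} K → Valid n K → Mem n x K → x ≤ n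
Mem⇒≤n (reg i j) (_ , _ , j≤n , _) (_ , x≤j) = ≤-trans x≤j j≤n
Mem⇒≤n (cyc i j) _ (inj₁ (_ , x≤n)) = x≤n
Mem⇒≤n (cyc i j) (_ , i<j , j≤n , _) (inj₂ (_ , x≤i)) = ≤-trans x≤i (≤-trans (<⇒≤ i<j) j≤n)

Mem-between : ∀ {n x y z} K → Valid n K → Mem n x K → Mem n z K → x < y → y < z
  → Mem n y K ⊎ (∀ {w} → 1 ≤ w → w ≤ x → Mem n w K)
Mem-between (reg i j) _ (i≤x , _) (_ , z≤j) x<y y<z =
  inj₁ (≤-trans i≤x (<⇒≤ x<y) , ≤-trans (<⇒≤ y<z) z≤j)
Mem-between (cyc i j) vK (inj₁ (j≤x , _)) z∈K x<y y<z =
  inj₁ (inj₁ (≤-trans j≤x (<⇒≤ x<y) , ≤-trans (<⇒≤ y<z) (Mem⇒≤n (cyc i j) vK z∈K)))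
Mem-between (cyc i j) _ (inj₂ (_ , x≤i)) _ _ _ = inj₂ λ 1≤w w≤x → inj₂ (1≤w , ≤-trans w≤x x≤i)

Mem-AB : ∀ {n} (G : CIH n) (A B : Interval → ℕ) → IsOrientation G A → IsOrientation G B
  → ∀ {K} → E G K → Mem n ((A AB) B K) K
Mem-AB G A B oA oB {K} eK with ⊔-sel (A K) (B K)
... | inj₁ eq rewrite eq = oA K eK
... | inj₂ eq rewrite eq = oB K eK

module _ {X : Set} where

  extend : ℕ → (ℕ → X) → X → ℕ → X
  extend k f y x with x ≤? k
  ... | yes _ = f x
  ... | no _ = y

  extend-≤ : ∀ {k x} (f : ℕ → X) (y : X) → x ≤ k → extend k f y x ≡ f x
  extend-≤ {k} {x} f y x≤k with x ≤? k
  ... | yes _ = refl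
  ... | no x≰k = contradiction x≤k x≰k

  extend-suc : ∀ k (f : ℕ → X) (y : X) → extend k f y (suc k) ≡ y
  extend-suc k f y with suc k ≤? k
  ... | yes k<k = contradiction k<k (<-irrefl refl)
  ... | no _ = refl

record OpenSeq {n} (G : CIH n) (A B : Interval → ℕ) (H : Interval) (ℓ v : ℕ) : Set where
  field
    k      : ℕ
    1≤k    : 1 ≤ k
    Hs     : ℕ → Interval
    hs     : ℕ → ℕ
    edges  : ∀ i → 1 ≤ i → i ≤ k → E G (Hs i)
    mems   : ∀ i → 1 ≤ i → i ≤ k → Mem n (hs i) (Hs i)
    first  : Hs 1 ≡ H
    firstℓ : hs 1 ≡ ℓ
    isAB   : ∀ i → 2 ≤ i → i ≤ k → hs i ≡ (A AB) B (Hs i)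
    link   : ∀ i → 1 ≤ i → i < k → Mem n (hs i) (Hs (suc i))
    incr   : ∀ i → 1 ≤ i → i < k → hs i < hs (suc i)
    ends   : hs k ≡ v

SeqTo : ∀ {n} → CIH n → (A B : Interval → ℕ) → Interval → ℕ → ℕ → Set
SeqTo G A B H ℓ x = Σ[ S ∈ Seq G A B H ℓ ] lastH S ≡ x

module _ {n} {G : CIH n} {A B : Interval → ℕ} {H : Interval} {ℓ : ℕ} where

  forget : (S : Seq G A B H ℓ) → OpenSeq G A B H ℓ (lastH S)
  forget S = record
    { k = k S ; 1≤k = 1≤k S ; Hs = Hs S ; hs = hs S ; edges = edges S ; mems = mems S
    ; first = first S ; firstℓ = firstℓ S ; isAB = isAB S ; link = link S ; incr = incr S
    ; ends = refl }

  close : ∀ {v} → OpenSeq G A B H ℓ v → Mem n v H → SeqTo G A B H ℓ v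
  close P v∈H = record
    { k = P.k ; 1≤k = P.1≤k ; Hs = P.Hs ; hs = P.hs ; edges = P.edges ; mems = P.mems
    ; first = P.first ; firstℓ = P.firstℓ ; isAB = P.isAB ; link = P.link ; incr = P.incr
    ; back = subst (λ x → Mem n x H) (sym P.ends) v∈H } , P.ends
    where module P = OpenSeq P

  start : E G H → Mem n ℓ H → OpenSeq G A B H ℓ ℓ
  start eH ℓ∈H = record
    { k = 1 ; 1≤k = ≤-refl ; Hs = λ _ → H ; hs = λ _ → ℓ
    ; edges = λ _ _ _ → eH ; mems = λ _ _ _ → ℓ∈H ; first = refl ; firstℓ = refl
    ; isAB = λ { _ (s≤s (s≤s _)) (s≤s ()) }
    ; link = λ { _ (s≤s _) (s≤s ()) } ; incr = λ { _ (s≤s _) (s≤s ()) }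
    ; ends = refl }

  snoc : ∀ {u v K} → OpenSeq G A B H ℓ u → E G K → Mem n v K → v ≡ (A AB) B K
    → Mem n u K → u < v → OpenSeq G A B H ℓ v
  snoc {v = v} {K} P eK v∈K v≡K_AB u∈K u<v = record
    { k = suc P.k ; 1≤k = m≤n⇒m≤1+n P.1≤k
    ; Hs = extend P.k P.Hs K ; hs = extend P.k P.hs v
    ; edges = edges′ ; mems = mems′
    ; first = trans (extend-≤ P.Hs K P.1≤k) P.first
    ; firstℓ = trans (extend-≤ P.hs v P.1≤k) P.firstℓ
    ; isAB = isAB′ ; link = link′ ; incr = incr′
    ; ends = extend-suc P.k P.hs v }
    where
    module P = OpenSeq P

    old-or-new : ∀ {i} → i ≤ suc P.k → i ≤ P.k ⊎ i ≡ suc P.k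
    old-or-new = map₁ m<1+n⇒m≤n ∘ m≤n⇒m<n∨m≡n

    edges′ : ∀ i → 1 ≤ i → i ≤ suc P.k → E G (extend P.k P.Hs K i)
    edges′ i 1≤i i≤k+1 with old-or-new i≤k+1
    ... | inj₁ i≤k rewrite extend-≤ P.Hs K i≤k = P.edges i 1≤i i≤k
    ... | inj₂ refl rewrite extend-suc P.k P.Hs K = eK

    mems′ : ∀ i → 1 ≤ i → i ≤ suc P.k → Mem n (extend P.k P.hs v i) (extend P.k P.Hs K i)
    mems′ i 1≤i i≤k+1 with old-or-new i≤k+1
    ... | inj₁ i≤k rewrite extend-≤ P.Hs K i≤k | extend-≤ P.hs v i≤k = P.mems i 1≤i i≤k
    ... | inj₂ refl rewrite extend-suc P.k P.Hs K | extend-suc P.k P.hs v = v∈K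

    isAB′ : ∀ i → 2 ≤ i → i ≤ suc P.k → extend P.k P.hs v i ≡ (A AB) B (extend P.k P.Hs K i)
    isAB′ i 2≤i i≤k+1 with old-or-new i≤k+1
    ... | inj₁ i≤k rewrite extend-≤ P.Hs K i≤k | extend-≤ P.hs v i≤k = P.isAB i 2≤i i≤k
    ... | inj₂ refl rewrite extend-suc P.k P.Hs K | extend-suc P.k P.hs v = v≡K_AB

    link′ : ∀ i → 1 ≤ i → i < suc P.k → Mem n (extend P.k P.hs v i) (extend P.k P.Hs K (suc i))
    link′ i 1≤i i<k+1 with m<1+n⇒m<n∨m≡n i<k+1
    ... | inj₁ i<k rewrite extend-≤ P.hs v (<⇒≤ i<k) | extend-≤ P.Hs K i<k = P.link i 1≤i i<k
    ... | inj₂ refl rewrite extend-≤ P.hs v (≤-refl {P.k}) | extend-suc P.k P.Hs K | P.ends = u∈K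

    incr′ : ∀ i → 1 ≤ i → i < suc P.k → extend P.k P.hs v i < extend P.k P.hs v (suc i)
    incr′ i 1≤i i<k+1 with m<1+n⇒m<n∨m≡n i<k+1
    ... | inj₁ i<k rewrite extend-≤ P.hs v (<⇒≤ i<k) | extend-≤ P.hs v i<k = P.incr i 1≤i i<k
    ... | inj₂ refl rewrite extend-≤ P.hs v (≤-refl {P.k}) | extend-suc P.k P.hs v | P.ends = u<v

module _ {n} {G : CIH n} {A B : Interval → ℕ} {H : Interval} {ℓ ℓ' : ℕ} (S : Seq G A B H ℓ') where

  snoc-entry : ∀ {u q} → OpenSeq G A B H ℓ u → 2 ≤ q → q ≤ k S
    → Mem n u (Hs S q) → u < hs S q → OpenSeq G A B H ℓ (hs S q)
  snoc-entry P 2≤q q≤r =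
    snoc P (edges S _ (<⇒≤ 2≤q) q≤r) (mems S _ (<⇒≤ 2≤q) q≤r) (isAB S _ 2≤q q≤r)

  splice : ∀ {u q} → OpenSeq G A B H ℓ u → 2 ≤ q → q ≤‴ k S
    → Mem n u (Hs S q) → u < hs S q → SeqTo G A B H ℓ (lastH S)
  splice P 2≤q ≤‴-refl u∈ u< = close (snoc-entry P 2≤q ≤-refl u∈ u<) (back S)
  splice {q = q} P 2≤q (≤‴-step q<‴r) u∈ u< =
    splice (snoc-entry P 2≤q (<⇒≤ q<r) u∈ u<) (m≤n⇒m≤1+n 2≤q) q<‴r
      (link S q (<⇒≤ 2≤q) q<r) (incr S q (<⇒≤ 2≤q) q<r)
    where
    q<r : suc q ≤ k S
    q<r = ≤‴⇒≤ q<‴r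

  -- Walk along S while h̃_q ≤ a. At the first q with a < h̃_q, either a ∈ H̃_q, or H̃_q
  -- wraps around and so contains [1, h̃_{q-1}] ∋ p.
  reroute : ∀ {p a} → OpenSeq G A B H ℓ p → OpenSeq G A B H ℓ a → 1 ≤ p → a < lastH S
    → ∀ {d} → 1 ≤ d → suc d ≤‴ k S → p < hs S (suc d)
    → Mem n a (Hs S (suc d)) ⊎ (p < hs S d × hs S d < a)
    → SeqTo G A B H ℓ (lastH S)
  reroute {p} {a} P Q 1≤p a<last {d} 1≤d q≤‴r p<h a∈⊎h<a with a <? hs S (suc d)
  ... | yes a<h = splice-P⊎Q (a∈⊎p∈ a∈⊎h<a)
    where
    q≤r : suc d ≤ k S
    q≤r = ≤‴⇒≤ q≤‴r

    a∈⊎p∈ : Mem n a (Hs S (suc d)) ⊎ (p < hs S d × hs S d < a)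
      → Mem n a (Hs S (suc d)) ⊎ Mem n p (Hs S (suc d))
    a∈⊎p∈ (inj₁ a∈) = inj₁ a∈
    a∈⊎p∈ (inj₂ (p<h′ , h′<a))
      with Mem-between _ (valid G _ (edges S _ (s≤s z≤n) q≤r))
             (link S d 1≤d q≤r) (mems S _ (s≤s z≤n) q≤r) h′<a a<h
    ... | inj₁ a∈ = inj₁ a∈
    ... | inj₂ prefix∈ = inj₂ (prefix∈ 1≤p (<⇒≤ p<h′))

    splice-P⊎Q : Mem n a (Hs S (suc d)) ⊎ Mem n p (Hs S (suc d)) → SeqTo G A B H ℓ (lastH S)
    splice-P⊎Q (inj₁ a∈) = splice Q (s≤s 1≤d) q≤‴r a∈ a<h
    splice-P⊎Q (inj₂ p∈) = splice P (s≤s 1≤d) q≤‴r p∈ p<h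
  reroute P Q 1≤p a<last 1≤d (≤‴-reflexive q≡r) p<h a∈⊎h<a | no a≮h =
    contradiction (subst (λ i → _ < hs S i) (sym q≡r) a<last) a≮h
  reroute P Q 1≤p a<last {d} 1≤d (≤‴-step q<‴r) p<h a∈⊎h<a | no a≮h
    with m≤n⇒m<n∨m≡n (≮⇒≥ a≮h)
  ... | inj₁ h<a = reroute P Q 1≤p a<last (s≤s z≤n) q<‴r (<-trans p<h h<h′) (inj₂ (p<h , h<a))
    where
    h<h′ : hs S (suc d) < hs S (suc (suc d))
    h<h′ = incr S (suc d) (s≤s z≤n) (≤‴⇒≤ q<‴r)
  ... | inj₂ refl = splice Q (s≤s (s≤s z≤n)) q<‴r (link S (suc d) (s≤s z≤n) q<r) (incr S (suc d) (s≤s z≤n) q<r)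
    where
    q<r : suc (suc d) ≤ k S
    q<r = ≤‴⇒≤ q<‴r

lemma5p8 : (n : ℕ) (G : CIH n) (A B : Interval → ℕ)
    → IsOrientation G A → IsOrientation G B
    → Acyclic G A → Acyclic G B → Distinct G A B
    → (i j : ℕ) → E G (cyc i j)
    → (xH : ℕ) → IsX G A B (cyc i j) xH
    → (ℓ : ℕ) → Mem n ℓ (cyc i j) → IsXℓ G A B (cyc i j) ℓ xH
    → (ℓ' xℓ' : ℕ) → Mem n ℓ' (cyc i j)
    → (A AB) B (cyc i j) ≤ ℓ' → ℓ' < xH
    → IsXℓ G A B (cyc i j) ℓ' xℓ' → xH < xℓ'
    → (S : Seq G A B (cyc i j) ℓ') → lastH S ≡ xℓ'
    → (L : Interval) → E G L → Mem n ℓ L → ℓ < (A AB) B L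
    → MemPlus n xℓ' (cyc i j)
    → ∀ m → 2 ≤ m → m ≤ k S → xH < hs S m
    → ¬ Mem n ((A AB) B L) (Hs S m)
lemma5p8 n G A B oA oB _ _ _ i j eH xH _ ℓ ℓ∈H ((T , refl) , X-max) ℓ' xℓ' _ _ _ _ xH<xℓ' S refl
  L eL ℓ∈L ℓ<a (j≤xℓ' , _) (suc d) (s≤s 1≤d) m≤r xH<hₘ a∈Hₘ = by-cases (lastH S ≤? (A AB) B L)
  where
  viaL : OpenSeq G A B (cyc i j) ℓ ((A AB) B L)
  viaL = snoc (start eH ℓ∈H) eL (Mem-AB G A B oA oB eL) refl ℓ∈L ℓ<a

  exceeds : ∀ {x} → SeqTo G A B (cyc i j) ℓ x → lastH T < x → ⊥
  exceeds (S′ , refl) xH<x = <⇒≱ xH<x (X-max S′)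

  by-cases : Dec (lastH S ≤ (A AB) B L) → ⊥
  by-cases (yes xℓ'≤a) = exceeds (close viaL a∈H) (<-≤-trans xH<xℓ' xℓ'≤a)
    where
    a∈H : Mem n ((A AB) B L) (cyc i j)
    a∈H = inj₁ (≤-trans j≤xℓ' xℓ'≤a , Mem⇒≤n L (valid G L eL) (Mem-AB G A B oA oB eL))
  by-cases (no xℓ'≰a) =
    exceeds (reroute S (forget T) viaL xH≥1 (≰⇒> xℓ'≰a) 1≤d (≤⇒≤‴ m≤r) xH<hₘ (inj₁ a∈Hₘ)) xH<xℓ'
    where
    xH≥1 : 1 ≤ lastH T
    xH≥1 = Mem⇒1≤ (cyc i j) (valid G _ eH) (back T)
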